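{- Let $N\geq 3$ and consider search on the path $P_N$ where the target moves at most one step after each test ($k=1$). Then the minimum $n$ such that there exists a $(P_N,4)$-successful non-adaptive strategy with $n$ tests is $$n(P_N,4)=\left\lceil \frac N2\right\rceil-2.$$
   Context: Search model with $k=1$: the path $P_N$ has vertex set $\{1,\dots,N\}$, edges $\{i,i+1\}$ for $1\leq i<N$, and a loop at every vertex. For $\mathcal A\subseteq\{1,\dots,N\}$, $\Gamma_1(\mathcal A)$ is the set of vertices at distance at most $1$ from some vertex of $\mathcal A$. An unknown target occupies a vertex; a searcher performs tests $\mathcal T_1,\dots,\mathcal T_n\subseteq\{1,\dots,N\}$ sequentially in time; test $i$ returns $y_i=1$ if the target currently lies in $\mathcal T_i$ and $y_i=0$ otherwise; after each test the target moves to an adjacent vertex or stays. In a non-adaptive strategy all test sets $\mathcal T_1,\dots,\mathcal T_n$ are fixed in advance (they do not depend on test results). The sets of possible positions are $\mathcal D_0=\{1,\dots,N\}$ and $\mathcal D_i=\Gamma_1(\mathcal T_i\cap\mathcal D_{i-1})$ if $y_i=1$, $\mathcal D_i=\Gamma_1(\mathcal D_{i-1}\setminus\mathcal T_i)$ if $y_i=0$. A strategy with $n$ tests is $(P_N,s)$-successful if for every sequence of test results, $|\mathcal D_i|\leq s$ for some $i\in\{0,\dots,n\}$. -}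

module Defs where

open import Data.Nat using (ℕ; zero; suc; _≤_; _≤ᵇ_; pred)
open import Data.Bool using (Bool; true; false; _∧_; _∨_; not; if_then_else_)
open import Data.List using (List; []; _∷_; map; upTo)
open import Data.Nat.ListAction using (sum)
open import Data.List.Relation.Unary.Any using (Any)
open import Data.Vec using (Vec; []; _∷_)

-- A subset of the vertex set {1,…,N} of P_N, given by its characteristic
-- function on ℕ; values outside {1,…,N} are ignored (always masked below).
VSet : Set
VSet = ℕ → Bool

inP : ℕ → ℕ → Bool
inP N v = (1 ≤ᵇ v) ∧ (v ≤ᵇ N)

restrict : ℕ → VSet → VSet
restrict N A v = inP N v ∧ A v

allV : ℕ → VSet
allV N = inP N

_∩_ : VSet → VSet → VSet
(A ∩ B) v = A v ∧ B v

_∖_ : VSet → VSet → VSet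
(A ∖ B) v = A v ∧ not (B v)

Γ₁ : ℕ → VSet → VSet
Γ₁ N A v = inP N v ∧ (A' (pred v) ∨ A' v ∨ A' (suc v))
  where
  A' : VSet
  A' = restrict N A

card : ℕ → VSet → ℕ
card N A = sum (map (λ i → if restrict N A (suc i) then 1 else 0) (upTo N))

step : ℕ → VSet → VSet → Bool → VSet
step N D T true  = Γ₁ N (T ∩ D)
step N D T false = Γ₁ N (D ∖ T)

Ds : ℕ → ∀ {n} → VSet → Vec VSet n → Vec Bool n → List VSet
Ds N D []       []       = D ∷ []
Ds N D (T ∷ Ts) (y ∷ ys) = D ∷ Ds N (step N D T y) Ts ys

Successful : ℕ → ℕ → ∀ {n} → Vec VSet n → Set
Successful N s {n} T =
  (ys : Vec Bool n) → Any (λ D → card N D ≤ s) (Ds N (allV N) T ys)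

-- Upper bound: with n = m + 1 tests, test [1, m + 3] first, then widen the test by one vertex on
-- each side every time. A positive first answer confines the target to [1, m + 4]; from then on,
-- while it is confined to [1, lo + 1], the test [lo, hi] either leaves it in [lo, lo + 1], whose
-- neighbourhood has at most 4 vertices, or confines it to [1, lo]. A negative first answer is
-- symmetric on [m + 3, N]. Either way every test shortens the interval by one, which suffices
-- when N ≤ 2n + 4.
-- Lower bound: an adversary keeps five possible positions in a window that grows by one vertex on
-- each side per test. One of T ∩ D and D ∖ T keeps three of them, and Γ₁ of a set with c ≥ 1
-- elements in the window has c + 2 elements in the widened window. When 2n + 5 ≤ N the window
-- stays inside the path for all n tests, so no D_i has fewer than five elements.
module Submission where

open import Defs
open import Data.Nat using (ℕ; _≤_; _∸_; ⌈_/2⌉)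
open import Data.Product using (Σ; _×_)
open import Data.Vec using (Vec)

open import Data.Nat
  using (zero; suc; _+_; _*_; _<_; _⊔_; _≤ᵇ_; pred; z≤n; s≤s; s≤s⁻¹; z<s; _≤?_)
open import Data.Nat.Properties
open import Data.Nat.Tactic.RingSolver using (solve-∀)
open import Data.Bool using (Bool; true; false; T; _∧_; not; if_then_else_)
open import Data.Bool.Properties using (T-∧; T-∨; T-≡)
open import Data.Product using (_,_; proj₁; proj₂)
open import Data.Sum using (_⊎_; inj₁; inj₂; map₂)
import Data.Sum as Sum
open import Data.List using (map; applyUpTo)
open import Data.Nat.ListAction using (sum)
open import Data.Vec using ([]; _∷_)
open import Data.List.Relation.Unary.All using (All; _∷_; [])
open import Data.List.Relation.Unary.All.Properties using (Any¬⇒¬All)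
open import Data.List.Relation.Unary.Any using (Any; here; there)
import Data.List.Relation.Unary.Any as Any
open import Function using (Equivalence)
open import Relation.Binary.PropositionalEquality
  using (_≡_; refl; sym; trans; cong; cong₂; subst; module ≡-Reasoning)
open import Relation.Nullary using (¬_; Dec; yes; no; contradiction)
open import Relation.Nullary.Decidable using (T?)

open Equivalence using (to; from)

private
  variable
    N : ℕ

indicator : Bool → ℕ
indicator b = if b then 1 else 0

indicator-T : ∀ {b} → T b → indicator b ≡ 1
indicator-T {true} _ = refl

1≤indicator : ∀ {b} → T b → 1 ≤ indicator b
1≤indicator t = ≤-reflexive (sym (indicator-T t))

indicator-F : ∀ {b} → ¬ T b → indicator b ≡ 0
indicator-F {false} _   = refl
indicator-F {true}  b∉ = contradiction _ b∉

indicator≤1 : ∀ b → indicator b ≤ 1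
indicator≤1 false = z≤n
indicator≤1 true  = ≤-refl

indicator-mono : ∀ {b c} → (T b → T c) → indicator b ≤ indicator c
indicator-mono {false} _ = z≤n
indicator-mono {true}  f = 1≤indicator (f _)

-- inP N and allV N are definitionally interval 1 N.
interval : ℕ → ℕ → VSet
interval lo hi v = (lo ≤ᵇ v) ∧ (v ≤ᵇ hi)

interval⁺ : ∀ {lo hi v} → lo ≤ v → v ≤ hi → T (interval lo hi v)
interval⁺ lo≤v v≤hi = from T-∧ (≤⇒≤ᵇ lo≤v , ≤⇒≤ᵇ v≤hi)

Above Below : ℕ → VSet → Set
Above l A = ∀ v → T (A v) → l ≤ v
Below r A = ∀ v → T (A v) → v ≤ r

interval-above : ∀ lo hi → Above lo (interval lo hi)
interval-above lo hi v v∈ = ≤ᵇ⇒≤ lo v (proj₁ (to T-∧ v∈))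

interval-below : ∀ lo hi → Below hi (interval lo hi)
interval-below lo hi v v∈ = ≤ᵇ⇒≤ v hi (proj₂ (to T-∧ v∈))

∩⁻ : ∀ A B v → T ((A ∩ B) v) → T (A v) × T (B v)
∩⁻ A B v = to T-∧

∖⁻ : ∀ A B v → T ((A ∖ B) v) → T (A v) × ¬ T (B v)
∖⁻ A B v v∈ = proj₁ (to T-∧ v∈) , not-T (proj₂ (to T-∧ v∈))
  where
  not-T : ∀ {b} → T (not b) → ¬ T b
  not-T {false} _ ()

∖-interval-below : ∀ D {r} m hi → Below r D → r ≤ hi → Below m (D ∖ interval (suc m) hi)
∖-interval-below D m hi below r≤hi v v∈ with ∖⁻ D (interval (suc m) hi) v v∈ | suc m ≤? v
... | v∈D , v∉I | yes m<v = contradiction (interval⁺ m<v (≤-trans (below v v∈D) r≤hi)) v∉I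
... | _         | no m≮v  = s≤s⁻¹ (≰⇒> m≮v)

∖-interval-above : ∀ D {l} lo h → Above l D → lo ≤ l → Above (suc h) (D ∖ interval lo h)
∖-interval-above D lo h above lo≤l v v∈ with ∖⁻ D (interval lo h) v v∈ | v ≤? h
... | v∈D , v∉I | yes v≤h = contradiction (interval⁺ (≤-trans lo≤l (above v v∈D)) v≤h) v∉I
... | _         | no v≰h  = ≰⇒> v≰h

Γ₁-cases : ∀ A {v} → T (Γ₁ N A v) → T (A (pred v)) ⊎ T (A v) ⊎ T (A (suc v))
Γ₁-cases A v∈ = Sum.map member (Sum.map member member) (map₂ (to T-∨) (to T-∨ (proj₂ (to T-∧ v∈))))
  where
  member : ∀ {u} → T (restrict _ A u) → T (A u)
  member u∈ = proj₂ (to T-∧ u∈)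

Γ₁-above : ∀ A {l} → Above l A → Above (pred l) (Γ₁ N A)
Γ₁-above A above v v∈ with Γ₁-cases A v∈
... | inj₁ left         = ≤⇒pred≤ (≤-trans (above _ left) pred[n]≤n)
... | inj₂ (inj₁ self)  = ≤⇒pred≤ (above _ self)
... | inj₂ (inj₂ right) = pred-mono-≤ (above _ right)

Γ₁-below : ∀ A {r} → Below r A → Below (suc r) (Γ₁ N A)
Γ₁-below A below v v∈ with Γ₁-cases A v∈
... | inj₁ left         = pred≤⇒≤suc v (below _ left)
  where
  pred≤⇒≤suc : ∀ v {r} → pred v ≤ r → v ≤ suc r
  pred≤⇒≤suc zero    _ = z≤n
  pred≤⇒≤suc (suc v) p = s≤s p
... | inj₂ (inj₁ self)  = m≤n⇒m≤1+n (below _ self)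
... | inj₂ (inj₂ right) = ≤-trans (n≤1+n v) (m≤n⇒m≤1+n (below _ right))

Γ₁-intro : ∀ Z {v} → 1 ≤ v → v ≤ N →
  T (restrict N Z (pred v)) ⊎ T (restrict N Z v) ⊎ T (restrict N Z (suc v)) → T (Γ₁ N Z v)
Γ₁-intro Z 1≤v v≤N near = from T-∧ (interval⁺ 1≤v v≤N , from T-∨ (map₂ (from T-∨) near))

Γ₁-self : ∀ Z {v} → 1 ≤ v → v ≤ N → T (Z v) → T (Γ₁ N Z v)
Γ₁-self Z 1≤v v≤N z = Γ₁-intro Z 1≤v v≤N (inj₂ (inj₁ (from T-∧ (interval⁺ 1≤v v≤N , z))))

Γ₁-suc : ∀ Z {v} → 1 ≤ v → v < N → T (Z v) → T (Γ₁ N Z (suc v))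
Γ₁-suc Z 1≤v v<N z = Γ₁-intro Z (s≤s z≤n) v<N (inj₁ (from T-∧ (interval⁺ 1≤v (<⇒≤ v<N) , z)))

Γ₁-pred : ∀ Z {v} → 1 ≤ v → v < N → T (Z (suc v)) → T (Γ₁ N Z v)
Γ₁-pred Z 1≤v v<N z =
  Γ₁-intro Z 1≤v (<⇒≤ v<N) (inj₂ (inj₂ (from T-∧ (interval⁺ (s≤s z≤n) v<N , z))))

count : ℕ → ℕ → VSet → ℕ
count a zero    B = 0
count a (suc k) B = indicator (B a) + count (suc a) k B

card≡count : ∀ N A → card N A ≡ count 1 N (restrict N A)
card≡count N A = sum-indicators N (λ i → i) 0 (λ _ → refl)
  where
  sum-indicators : ∀ k (f : ℕ → ℕ) a → (∀ i → f i ≡ a + i) →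
    sum (map (λ i → indicator (restrict N A (suc i))) (applyUpTo f k)) ≡ count (suc a) k (restrict N A)
  sum-indicators zero    f a f≗a+ = refl
  sum-indicators (suc k) f a f≗a+ =
    cong₂ _+_ (cong (λ x → indicator (restrict N A (suc x))) (trans (f≗a+ 0) (+-identityʳ a)))
              (sum-indicators k (λ i → f (suc i)) (suc a) (λ i → trans (f≗a+ (suc i)) (+-suc a i)))

count-++ : ∀ a m k B → count a (m + k) B ≡ count a m B + count (a + m) k B
count-++ a zero    k B = cong (λ x → count x k B) (sym (+-identityʳ a))
count-++ a (suc m) k B = begin
  indicator (B a) + count (suc a) (m + k) B
    ≡⟨ cong (indicator (B a) +_) (count-++ (suc a) m k B) ⟩
  indicator (B a) + (count (suc a) m B + count (suc a + m) k B)
    ≡⟨ sym (+-assoc (indicator (B a)) _ _) ⟩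
  count a (suc m) B + count (suc a + m) k B
    ≡⟨ cong (λ x → count a (suc m) B + count x k B) (sym (+-suc a m)) ⟩
  count a (suc m) B + count (a + suc m) k B ∎
  where open ≡-Reasoning

count-mono : ∀ a k B C → (∀ v → a ≤ v → v < a + k → T (B v) → T (C v)) → count a k B ≤ count a k C
count-mono a zero    B C B⊆C = z≤n
count-mono a (suc k) B C B⊆C =
  +-mono-≤ (indicator-mono (B⊆C a ≤-refl (m<m+n a z<s)))
           (count-mono (suc a) k B C (λ v a<v v<end → B⊆C v (<⇒≤ a<v) (subst (v <_) (sym (+-suc a k)) v<end)))

count-∩-∖ : ∀ a k D S → count a k (S ∩ D) + count a k (D ∖ S) ≡ count a k D
count-∩-∖ a zero    D S = refl
count-∩-∖ a (suc k) D S with D a | S a | count-∩-∖ (suc a) k D S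
... | true  | true  | split = cong suc split
... | true  | false | split = trans (+-suc _ _) (cong suc split)
... | false | true  | split = split
... | false | false | split = split

count-bound : ∀ a k B {l r} → Above l B → Below r B → count a k B ≤ suc r ∸ (a ⊔ l)
count-bound a zero    B above below = z≤n
count-bound a (suc k) B {l} {r} above below with B a in eq
... | false = ≤-trans (count-bound (suc a) k B above below) (∸-monoʳ-≤ (suc r) (⊔-monoˡ-≤ l (n≤1+n a)))
... | true  = begin
  suc (count (suc a) k B)         ≤⟨ s≤s (count-bound (suc a) k B above below) ⟩
  suc (suc r ∸ (suc a ⊔ l))       ≡⟨ cong (λ x → suc (suc r ∸ x)) (m≥n⇒m⊔n≡m (m≤n⇒m≤1+n l≤a)) ⟩
  suc (r ∸ a)                     ≡⟨ sym (+-∸-assoc 1 (below a a∈B)) ⟩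
  suc r ∸ a                       ≡⟨ cong (suc r ∸_) (sym (m≥n⇒m⊔n≡m l≤a)) ⟩
  suc r ∸ (a ⊔ l)                 ∎
  where
  open ≤-Reasoning
  a∈B : T (B a)
  a∈B = from T-≡ eq
  l≤a : l ≤ a
  l≤a = above a a∈B

restrict-above : ∀ N A {l} → Above l A → Above l (restrict N A)
restrict-above N A above v v∈ = above v (proj₂ (to T-∧ v∈))

restrict-below : ∀ N A {r} → Below r A → Below r (restrict N A)
restrict-below N A below v v∈ = below v (proj₂ (to T-∧ v∈))

restrict-below-N : ∀ N A → Below N (restrict N A)
restrict-below-N N A v v∈ = interval-below 1 N v (proj₁ (to T-∧ v∈))

card-bound : ∀ N A {l r} → Above l A → Below r A → card N A ≤ suc r ∸ (1 ⊔ l)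
card-bound N A above below = subst (_≤ _) (sym (card≡count N A))
  (count-bound 1 N (restrict N A) (restrict-above N A above) (restrict-below N A below))

card-above : ∀ N A {l} → Above (suc l) A → card N A ≤ N ∸ l
card-above N A above = subst (_≤ _) (sym (card≡count N A))
  (count-bound 1 N (restrict N A) (restrict-above N A above) (restrict-below-N N A))

count≤card : ∀ p k D → suc p + k ≤ suc N → count (suc p) k D ≤ card N D
count≤card {N} p k D window = begin
  count (suc p) k D                               ≤⟨ count-mono (suc p) k D R inside ⟩
  count (suc p) k R                               ≤⟨ m≤m+n _ _ ⟩
  count (suc p) k R + count (suc p + k) rest R    ≡⟨ sym (count-++ (suc p) k rest R) ⟩
  count (suc p) (k + rest) R                      ≤⟨ m≤n+m _ _ ⟩
  count 1 p R + count (suc p) (k + rest) R        ≡⟨ sym (count-++ 1 p (k + rest) R) ⟩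
  count 1 (p + (k + rest)) R                      ≡⟨ cong (λ x → count 1 x R) covers ⟩
  count 1 N R                                     ≡⟨ sym (card≡count N D) ⟩
  card N D                                        ∎
  where
  open ≤-Reasoning
  R = restrict N D
  rest = N ∸ (p + k)
  inside : ∀ v → suc p ≤ v → v < suc p + k → T (D v) → T (R v)
  inside v p<v v<end v∈D =
    from T-∧ (interval⁺ (≤-trans (s≤s z≤n) p<v) (s≤s⁻¹ (≤-trans v<end window)) , v∈D)
  covers : p + (k + rest) ≡ N
  covers = trans (sym (+-assoc p k rest)) (m+[n∸m]≡n (s≤s⁻¹ window))

count-interval : ∀ a k lo hi → lo ≤ a → a + k ≤ suc hi → count a k (interval lo hi) ≡ k
count-interval a zero    lo hi lo≤a window = refl
count-interval a (suc k) lo hi lo≤a window =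
  cong₂ _+_ (indicator-T (interval⁺ lo≤a (s≤s⁻¹ (≤-trans (m<m+n a z<s) window))))
            (count-interval (suc a) k lo hi (m≤n⇒m≤1+n lo≤a) (subst (_≤ suc hi) (+-suc a k) window))

count-shift-Γ₁ : ∀ Z a k → 1 ≤ a → a + k ≤ N → count a k Z ≤ count (suc a) k (Γ₁ N Z)
count-shift-Γ₁ Z a zero    1≤a window = z≤n
count-shift-Γ₁ {N} Z a (suc k) 1≤a window =
  +-mono-≤ (indicator-mono (Γ₁-suc Z 1≤a (<-≤-trans (m<m+n a z<s) window)))
           (count-shift-Γ₁ Z (suc a) k (s≤s z≤n) (subst (_≤ N) (+-suc a k) window))

count-skip : ∀ a k B → ¬ T (B a) → count a (suc k) B ≡ count (suc a) k B
count-skip a k B a∉B = cong (_+ count (suc a) k B) (indicator-F a∉B)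

-- The first element u of Z in the window contributes u - 1, u and u + 1 to Γ₁ Z,
-- and the rest of the window reappears in Γ₁ Z shifted by one.
count-Γ₁-grows : ∀ Z a k → 1 ≤ a → suc a + k ≤ N → 1 ≤ count (suc a) k Z →
  2 + count (suc a) k Z ≤ count a (2 + k) (Γ₁ N Z)
count-Γ₁-grows {N} Z a (suc k) 1≤a window nonempty with T? (Z (suc a))
... | yes u∈Z =
  ≤-trans (s≤s (s≤s (+-monoˡ-≤ _ (indicator≤1 (Z (suc a))))))
  (+-mono-≤ (1≤indicator (Γ₁-pred Z 1≤a (<⇒≤ a+1<N) u∈Z))
  (+-mono-≤ (1≤indicator (Γ₁-self Z (s≤s z≤n) (<⇒≤ a+1<N) u∈Z))
  (+-mono-≤ (1≤indicator (Γ₁-suc Z (s≤s z≤n) a+1<N u∈Z))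
            (count-shift-Γ₁ Z (suc (suc a)) k (s≤s z≤n) window′))))
  where
  a+1<N : suc a < N
  a+1<N = <-≤-trans (m<m+n (suc a) z<s) window
  window′ : suc (suc a) + k ≤ N
  window′ = subst (_≤ N) (+-suc (suc a) k) window
... | no u∉Z = subst (λ c → 2 + c ≤ count a (3 + k) (Γ₁ N Z)) (sym skip)
  (≤-trans (count-Γ₁-grows Z (suc a) k (s≤s z≤n) window′ (subst (1 ≤_) skip nonempty))
           (m≤n+m _ (indicator (Γ₁ N Z a))))
  where
  skip = count-skip (suc a) k Z u∉Z
  window′ = subst (_≤ N) (+-suc (suc a) k) window

5≤+⇒3≤ : ∀ x y → 5 ≤ x + y → ¬ 3 ≤ x → 3 ≤ y
5≤+⇒3≤ x y five ¬three = +-cancelˡ-≤ 2 3 y (≤-trans five (+-monoˡ-≤ y (s≤s⁻¹ (≰⇒> ¬three))))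

adversary-step : ∀ a k D S → 1 ≤ a → suc a + k ≤ N → 5 ≤ count (suc a) k D →
  Σ Bool λ y → 5 ≤ count a (2 + k) (step N D S y)
adversary-step {N} a k D S 1≤a window five = choose (3 ≤? count (suc a) k (S ∩ D))
  where
  grows : ∀ Z → 3 ≤ count (suc a) k Z → 5 ≤ count a (2 + k) (Γ₁ N Z)
  grows Z three = ≤-trans (s≤s (s≤s three)) (count-Γ₁-grows Z a k 1≤a window (≤-trans (s≤s z≤n) three))
  choose : Dec (3 ≤ count (suc a) k (S ∩ D)) → Σ Bool λ y → 5 ≤ count a (2 + k) (step N D S y)
  choose (yes three) = true , grows (S ∩ D) three
  choose (no ¬three) = false , grows (D ∖ S)
    (5≤+⇒3≤ _ _ (subst (5 ≤_) (sym (count-∩-∖ (suc a) k D S)) five) ¬three)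

adversary : ∀ m a k D (Ts : Vec VSet m) → m < a → m + (a + k) ≤ suc N → 5 ≤ count a k D →
  Σ (Vec Bool m) λ ys → All (λ E → 4 < card N E) (Ds N D Ts ys)
adversary zero    (suc a) k D []       _         window five = [] , ≤-trans five (count≤card a k D window) ∷ []
adversary {N} (suc m) (suc a) k D (S ∷ Ts) (s≤s m<a) window five =
  let (y , five′)  = adversary-step a k D S (≤-trans (s≤s z≤n) m<a)
                                            (≤-trans (m≤n+m _ m) (s≤s⁻¹ window)) five
      (ys , large) = adversary m a (2 + k) (step N D S y) Ts m<a (subst (_≤ suc N) (sym (slack m a k)) window) five′
  in y ∷ ys , ≤-trans five (count≤card a k D (≤-trans (m≤n+m _ (suc m)) window)) ∷ large
  where
  slack : ∀ m a k → m + (a + (2 + k)) ≡ suc m + (suc a + k)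
  slack = solve-∀

short-strategies-fail : ∀ n (Ts : Vec VSet n) → 2 * n + 5 ≤ N → ¬ Successful N 4 Ts
short-strategies-fail {N} n Ts size successful =
  let (ys , large) = adversary n (suc n) 5 (allV N) Ts ≤-refl window five
  in Any¬⇒¬All (Any.map ≤⇒≯ (successful ys)) large
  where
  slack : ∀ n → suc (2 * n + 5) ≡ n + (suc n + 5)
  slack = solve-∀
  window : n + (suc n + 5) ≤ suc N
  window = subst (_≤ suc N) (slack n) (s≤s size)
  five : 5 ≤ count (suc n) 5 (allV N)
  five = ≤-reflexive (sym (count-interval (suc n) 5 1 N (s≤s z≤n) (≤-trans (m≤n+m _ n) window)))

Any-head : ∀ {P : VSet → Set} N D {m} (Ts : Vec VSet m) ys → P D → Any P (Ds N D Ts ys)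
Any-head N D []       []       p = here p
Any-head N D (_ ∷ _) (_ ∷ _) p = here p

card-Γ₁-pair : ∀ N A l → Above (suc l) A → Below (suc (suc l)) A → card N (Γ₁ N A) ≤ 4
card-Γ₁-pair N A l above below = begin
  card N (Γ₁ N A)  ≤⟨ card-bound N (Γ₁ N A) (Γ₁-above A above) (Γ₁-below A below) ⟩
  4 + l ∸ (1 ⊔ l)  ≤⟨ ∸-monoʳ-≤ (4 + l) (m≤n⊔m 1 l) ⟩
  4 + l ∸ l        ≡⟨ m+n∸n≡m 4 l ⟩
  4                ∎
  where open ≤-Reasoning

widening : ℕ → ℕ → (m : ℕ) → Vec VSet m
widening lo hi zero    = []
widening lo hi (suc m) = interval lo hi ∷ widening (pred lo) (suc hi) m

strategy : (n : ℕ) → Vec VSet n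
strategy zero    = []
strategy (suc m) = interval 1 (3 + m) ∷ widening (3 + m) (4 + m) m

left-sweep : ∀ m lo hi D → Below (suc lo) D → suc lo ≤ hi → lo ≤ 3 + m →
  ∀ ys → Any (λ E → card N E ≤ 4) (Ds N D (widening lo hi m) ys)
left-sweep {N} zero lo hi D below _ lo≤3 [] = here (≤-trans (card-bound N D (λ _ _ → z≤n) below) (s≤s lo≤3))
left-sweep {N} (suc m) zero hi D below _ _ ys =
  Any-head N D _ ys (≤-trans (card-bound N D (λ _ _ → z≤n) below) (s≤s z≤n))
left-sweep {N} (suc m) (suc lo) hi D below lo<hi _ (true ∷ ys) =
  there (Any-head N _ _ ys (card-Γ₁-pair N (I ∩ D) lo
    (λ v v∈ → interval-above (suc lo) hi v (proj₁ (∩⁻ I D v v∈)))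
    (λ v v∈ → below v (proj₂ (∩⁻ I D v v∈)))))
  where I = interval (suc lo) hi
left-sweep {N} (suc m) (suc lo) hi D below lo<hi lo≤ (false ∷ ys) =
  there (left-sweep m lo (suc hi) (Γ₁ N (D ∖ interval (suc lo) hi))
    (Γ₁-below _ (∖-interval-below D lo hi below lo<hi))
    (≤-trans (n≤1+n _) (m≤n⇒m≤1+n lo<hi)) (s≤s⁻¹ lo≤) ys)

right-sweep : ∀ m lo l D → Above (suc l) D → lo ≤ suc l → N ≤ m + (4 + l) →
  ∀ ys → Any (λ E → card N E ≤ 4) (Ds N D (widening lo (suc (suc l)) m) ys)
right-sweep {N} zero lo l D above _ N≤ [] =
  here (≤-trans (card-above N D above) (≤-trans (∸-monoˡ-≤ l N≤) (≤-reflexive (m+n∸n≡m 4 l))))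
right-sweep {N} (suc m) lo l D above _ _ (true ∷ ys) =
  there (Any-head N _ _ ys (card-Γ₁-pair N (I ∩ D) l
    (λ v v∈ → above v (proj₂ (∩⁻ I D v v∈)))
    (λ v v∈ → interval-below lo (suc (suc l)) v (proj₁ (∩⁻ I D v v∈)))))
  where I = interval lo (suc (suc l))
right-sweep {N} (suc m) lo l D above lo≤ N≤ (false ∷ ys) =
  there (right-sweep m (pred lo) (suc l) (Γ₁ N (D ∖ interval lo (suc (suc l))))
    (Γ₁-above _ (∖-interval-above D lo (suc (suc l)) above lo≤)) (≤⇒pred≤ (m≤n⇒m≤1+n lo≤))
    (subst (N ≤_) (sym (+-suc m (4 + l))) N≤) ys)

strategy-successful : ∀ n → N ≤ 2 * n + 4 → Successful N 4 (strategy n)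
strategy-successful {N} zero N≤4 [] = here (≤-trans (card-bound N (allV N) (λ _ _ → z≤n) (interval-below 1 N)) N≤4)
strategy-successful {N} (suc m) _ (true ∷ ys) =
  there (left-sweep m (3 + m) (4 + m) (Γ₁ N (I ∩ allV N))
    (Γ₁-below (I ∩ allV N) (λ v v∈ → interval-below 1 (3 + m) v (proj₁ (∩⁻ I (allV N) v v∈))))
    ≤-refl ≤-refl ys)
  where I = interval 1 (3 + m)
strategy-successful {N} (suc m) N≤ (false ∷ ys) =
  there (right-sweep m (3 + m) (2 + m) (Γ₁ N (allV N ∖ I))
    (Γ₁-above (allV N ∖ I) (∖-interval-above (allV N) 1 (3 + m) (interval-above 1 N) ≤-refl)) ≤-refl
    (subst (N ≤_) (size m) N≤) ys)
  where
  I = interval 1 (3 + m)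
  size : ∀ m → 2 * suc m + 4 ≡ m + (4 + (2 + m))
  size = solve-∀

n≤⌈n/2⌉+⌈n/2⌉ : ∀ n → n ≤ ⌈ n /2⌉ + ⌈ n /2⌉
n≤⌈n/2⌉+⌈n/2⌉ n =
  subst (_≤ ⌈ n /2⌉ + ⌈ n /2⌉) (⌊n/2⌋+⌈n/2⌉≡n n) (+-monoˡ-≤ ⌈ n /2⌉ (⌊n/2⌋≤⌈n/2⌉ n))

⌈n/2⌉+⌈n/2⌉≤1+n : ∀ n → ⌈ n /2⌉ + ⌈ n /2⌉ ≤ suc n
⌈n/2⌉+⌈n/2⌉≤1+n n =
  subst (⌈ n /2⌉ + ⌈ n /2⌉ ≤_) (⌊n/2⌋+⌈n/2⌉≡n (suc n)) (+-monoʳ-≤ ⌈ n /2⌉ (⌈n/2⌉-mono (n≤1+n n)))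

n≤2*[⌈n/2⌉∸2]+4 : ∀ n → n ≤ 2 * (⌈ n /2⌉ ∸ 2) + 4
n≤2*[⌈n/2⌉∸2]+4 n = begin
  n                             ≤⟨ n≤⌈n/2⌉+⌈n/2⌉ n ⟩
  ⌈ n /2⌉ + ⌈ n /2⌉             ≤⟨ +-mono-≤ (m≤n+m∸n ⌈ n /2⌉ 2) (m≤n+m∸n ⌈ n /2⌉ 2) ⟩
  (2 + c) + (2 + c)             ≡⟨ double c ⟩
  2 * c + 4                     ∎
  where
  open ≤-Reasoning
  c = ⌈ n /2⌉ ∸ 2
  double : ∀ c → (2 + c) + (2 + c) ≡ 2 * c + 4
  double = solve-∀

m<⌈n/2⌉∸2⇒2*m+5≤n : ∀ m n → m < ⌈ n /2⌉ ∸ 2 → 2 * m + 5 ≤ n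
m<⌈n/2⌉∸2⇒2*m+5≤n m n m<c∸2 = s≤s⁻¹ (begin
  suc (2 * m + 5)               ≡⟨ double m ⟩
  (3 + m) + (3 + m)             ≤⟨ +-mono-≤ 3+m≤c 3+m≤c ⟩
  ⌈ n /2⌉ + ⌈ n /2⌉             ≤⟨ ⌈n/2⌉+⌈n/2⌉≤1+n n ⟩
  suc n                         ∎)
  where
  open ≤-Reasoning
  double : ∀ m → suc (2 * m + 5) ≡ (3 + m) + (3 + m)
  double = solve-∀
  <∸2⇒3+≤ : ∀ c → m < c ∸ 2 → 3 + m ≤ c
  <∸2⇒3+≤ (suc (suc c)) m<c = s≤s (s≤s m<c)
  3+m≤c : 3 + m ≤ ⌈ n /2⌉
  3+m≤c = <∸2⇒3+≤ ⌈ n /2⌉ m<c∸2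

theorem6 : (N : ℕ) → 3 ≤ N →
    Σ (Vec VSet (⌈ N /2⌉ ∸ 2)) (λ T → Successful N 4 T)
    × ((n : ℕ) (T : Vec VSet n) → Successful N 4 T → ⌈ N /2⌉ ∸ 2 ≤ n)
theorem6 N _ =
  (strategy (⌈ N /2⌉ ∸ 2) , strategy-successful (⌈ N /2⌉ ∸ 2) (n≤2*[⌈n/2⌉∸2]+4 N)) ,
  λ n Ts successful → ≮⇒≥ λ n<bound →
    short-strategies-fail n Ts (m<⌈n/2⌉∸2⇒2*m+5≤n n N n<bound) successful
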